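{- Let $n\ge 20$ with $n\equiv 0\pmod 5$. Then there exists a $5$-uniform hypergraph $\mathcal{H}=(V,\mathcal{E})$ with $EI(\mathcal{H})=C_n$ and $|\mathcal{E}|=\frac{3}{5}n$.
   Context: Hypergraphs $\mathcal{H}=(V,\mathcal{E})$ have no multiple hyperedges; isolated vertices are allowed. $\mathcal{H}$ is $5$-uniform if every hyperedge has exactly $5$ elements. The edge intersection hypergraph of $\mathcal{H}$ is $EI(\mathcal{H})=(V,\mathcal{E}^{EI})$ with $\mathcal{E}^{EI}=\{e_1\cap e_2: e_1,e_2\in\mathcal{E},\ e_1\ne e_2,\ |e_1\cap e_2|\ge 2\}$. $C_n$ is the cycle with vertex set $\{1,\dots,n\}$ and edges $\{i,i+1\}$, $i=1,\dots,n$ (indices mod $n$); "$EI(\mathcal{H})=C_n$" means $V=\{1,\dots,n\}$ and $\mathcal{E}^{EI}$ is exactly the edge set of $C_n$. -}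

module Defs where

open import Data.Nat using (ℕ; suc; _≥_)
open import Data.Fin using (Fin; toℕ; fromℕ<)
open import Data.Fin.Subset using (Subset; _∩_; _∪_; ⁅_⁆; ∣_∣)
open import Data.List using (List; length)
open import Data.List.Membership.Propositional using (_∈_)
open import Data.List.Relation.Unary.Unique.Propositional using (Unique)
open import Data.List.Relation.Unary.All using (All)
open import Data.Nat.DivMod using (_%_; m%n<n)
open import Data.Product using (Σ; ∃; ∃-syntax; _×_)
open import Relation.Binary.PropositionalEquality using (_≡_; _≢_)
open import Relation.Nullary using (¬_)

-- A hypergraph on vertex set Fin n: a duplicate-free list of hyperedges,
-- each hyperedge a subset of Fin n (so isolated vertices are allowed and
-- there are no multiple hyperedges).  |E| = length of the list.
record Hypergraph (n : ℕ) : Set where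
  field
    edges  : List (Subset n)
    unique : Unique edges
open Hypergraph public

Uniform : ∀ {n} → ℕ → Hypergraph n → Set
Uniform k H = All (λ e → ∣ e ∣ ≡ k) (edges H)

EIEdge : ∀ {n} → Hypergraph n → Subset n → Set
EIEdge H S = ∃[ e₁ ] ∃[ e₂ ]
  (e₁ ∈ edges H × e₂ ∈ edges H × e₁ ≢ e₂ × S ≡ e₁ ∩ e₂ × ∣ S ∣ ≥ 2)

-- successor mod n on Fin (suc m)  (vertices 1..n encoded as 0..n-1)
next : ∀ {m} → Fin (suc m) → Fin (suc m)
next {m} i = fromℕ< (m%n<n (suc (toℕ i)) (suc m))

CycleEdge : ∀ {m} → Subset (suc m) → Set
CycleEdge S = ∃[ i ] S ≡ ⁅ i ⁆ ∪ ⁅ next i ⁆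

EIisCycle : ∀ {m} → Hypergraph (suc m) → Set
EIisCycle H = ∀ S → (EIEdge H S → CycleEdge S) × (CycleEdge S → EIEdge H S)

module Submission where

-- Write n = 5K and cut the cycle into K blocks of five consecutive vertices. Each block b
-- carries three hyperedges, the translates by 5b of P = {0,…,4}, Q = {2,3,8,9,10} and
-- R = {4,5,6,11,12}; so there are 3K of them. Translation by 5 is an automorphism of the
-- construction, so the intersection of two hyperedges depends only on their kinds and on the
-- distance of their blocks. The patterns lie in [0,12], so blocks at distance ≥ 3 in both
-- directions are disjoint, and the remaining cases are a finite check: every intersection has
-- at most one vertex or is a cycle edge, and P∩R₋₁, P∩R₋₂, P∩Q, P∩Q₋₁, R∩Q₋₁ (subscripts
-- shift the block) are the five cycle edges starting in the block. Only for n = 20 do blocks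
-- at distance 2 meet across both ends of the cycle, which needs one more finite check.

open import Defs
open import Data.Bool using (Bool; true; false; _∧_; _∨_; not; T)
open import Data.Bool.Properties using (⇔→≡; T-≡; T-∧; T-not-≡; ∧-zeroʳ)
open import Data.Fin as Fin using (Fin; toℕ; fromℕ<)
open import Data.Fin.Properties using (toℕ-fromℕ<; toℕ-injective; toℕ<n)
open import Data.Fin.Subset using (Subset; _∩_; _∪_; ⁅_⁆; ∣_∣; _∉_; _⊆_; inside; outside)
  renaming (⊥ to ∅; _∈_ to _∈ₛ_)
open import Data.Fin.Subset.Properties
  using (∣⁅x⁆∣≡1; ∣⊥∣≡0; x∈⁅x⁆; x∈⁅y⁆⇒x≡y; ∪-identityˡ; ∩-comm; ∩-idem; p⊆q⇒∣p∣≤∣q∣)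
open import Data.List using (List; []; _∷_; length; applyUpTo; map; cartesianProductWith; allFin)
open import Data.List.Properties using (∷-injectiveˡ; ∷-injectiveʳ; length-++; length-map; length-tabulate)
open import Data.List.Relation.Unary.All using (All; []; _∷_)
import Data.List.Relation.Unary.All as All
open import Data.List.Relation.Unary.Any using (here; there)
open import Data.List.Relation.Unary.AllPairs using ([]; _∷_)
open import Data.List.Relation.Unary.Unique.Propositional using (Unique)
open import Data.List.Relation.Unary.Unique.Propositional.Properties using (cartesianProductWith⁺; allFin⁺)
open import Data.List.Membership.Propositional using (_∈_)
open import Data.List.Membership.Propositional.Properties
  using (∈-cartesianProductWith⁺; ∈-cartesianProductWith⁻; ∈-allFin)
open import Data.Nat
open import Data.Nat.DivMod
open import Data.Nat.Properties
open import Data.Nat.Tactic.RingSolver using (solve-∀)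
open import Data.Product using (Σ; ∃-syntax; _×_; _,_; proj₁; proj₂)
open import Data.Sum using (_⊎_; inj₁; inj₂)
open import Data.Vec using (Vec; _∷_; lookup; tabulate; here; there)
open import Data.Vec.Properties
  using (lookup∘tabulate; tabulate∘lookup; tabulate-cong; lookup-zipWith; lookup-replicate; []=⇒lookup; lookup⇒[]=)
open import Function using (_∘_; _⇔_; mk⇔; Equivalence)
open import Relation.Binary.PropositionalEquality
open import Relation.Nullary using (¬_; yes; no; contradiction)
open import Relation.Nullary.Decidable using (toWitness; decidable-stable; _×-dec_)
open import Relation.Binary.Definitions using (DecidableEquality)

open ≡-Reasoning

_∈ᵇ_ : ℕ → List ℕ → Bool
y ∈ᵇ []       = false
y ∈ᵇ (x ∷ xs) = (y ≡ᵇ x) ∨ (y ∈ᵇ xs)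

distinctᵇ : List ℕ → Bool
distinctᵇ []       = true
distinctᵇ (x ∷ xs) = not (x ∈ᵇ xs) ∧ distinctᵇ xs

≡ᵇ≡true⇔≡ : ∀ {a b} → (a ≡ᵇ b) ≡ true ⇔ a ≡ b
≡ᵇ≡true⇔≡ {a} {b} = mk⇔ (≡ᵇ⇒≡ a b ∘ Equivalence.from T-≡) (Equivalence.to T-≡ ∘ ≡⇒≡ᵇ a b)

≗-fromPrefix : ∀ {A : Set} w {f g : ℕ → A} →
  applyUpTo f w ≡ applyUpTo g w → (∀ z → f (w + z) ≡ g (w + z)) → ∀ y → f y ≡ g y
≗-fromPrefix zero    _ tail y       = tail y
≗-fromPrefix (suc w) e tail zero    = ∷-injectiveˡ e
≗-fromPrefix (suc w) e tail (suc y) = ≗-fromPrefix w (∷-injectiveʳ e) tail y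

lookup-≗⇒≡ : ∀ {A : Set} {n} {xs ys : Vec A n} → (∀ i → lookup xs i ≡ lookup ys i) → xs ≡ ys
lookup-≗⇒≡ {xs = xs} {ys} eq =
  trans (sym (tabulate∘lookup xs)) (trans (tabulate-cong eq) (tabulate∘lookup ys))

length-cartesianProductWith : ∀ {A B C : Set} (f : A → B → C) xs ys →
  length (cartesianProductWith f xs ys) ≡ length xs * length ys
length-cartesianProductWith f []       ys = refl
length-cartesianProductWith f (x ∷ xs) ys = trans (length-++ (map (f x) ys))
  (cong₂ _+_ (length-map (f x) ys) (length-cartesianProductWith f xs ys))

[m%n+o]%n≡[m+o]%n : ∀ m o n .{{_ : NonZero n}} → (m % n + o) % n ≡ (m + o) % n
[m%n+o]%n≡[m+o]%n m o n = begin
  (m % n + o) % n         ≡⟨ %-distribˡ-+ (m % n) o n ⟩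
  (m % n % n + o % n) % n ≡⟨ cong (λ z → (z + o % n) % n) (m%n%n≡m%n m n) ⟩
  (m % n + o % n) % n     ≡⟨ %-distribˡ-+ m o n ⟨
  (m + o) % n             ∎

lookup⁅⁆≡true⇔≡ : ∀ {n} (i x : Fin n) → lookup ⁅ i ⁆ x ≡ true ⇔ x ≡ i
lookup⁅⁆≡true⇔≡ i x = mk⇔
  (x∈⁅y⁆⇒x≡y i ∘ lookup⇒[]= x ⁅ i ⁆)
  (λ { refl → []=⇒lookup (x∈⁅x⁆ i) })

lookup≡false⇒∉ : ∀ {n} {p : Subset n} {x} → lookup p x ≡ false → x ∉ p
lookup≡false⇒∉ eq x∈p with () ← trans (sym ([]=⇒lookup x∈p)) eq

∣⁅x⁆∪p∣≡1+∣p∣ : ∀ {n} (x : Fin n) (p : Subset n) → x ∉ p → ∣ ⁅ x ⁆ ∪ p ∣ ≡ suc ∣ p ∣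
∣⁅x⁆∪p∣≡1+∣p∣ Fin.zero    (outside ∷ p) _   = cong (suc ∘ ∣_∣) (∪-identityˡ p)
∣⁅x⁆∪p∣≡1+∣p∣ Fin.zero    (inside  ∷ p) x∉p = contradiction here x∉p
∣⁅x⁆∪p∣≡1+∣p∣ (Fin.suc x) (outside ∷ p) x∉p = ∣⁅x⁆∪p∣≡1+∣p∣ x p (x∉p ∘ there)
∣⁅x⁆∪p∣≡1+∣p∣ (Fin.suc x) (inside  ∷ p) x∉p = cong suc (∣⁅x⁆∪p∣≡1+∣p∣ x p (x∉p ∘ there))

module _ {m : ℕ} where

  rot : ℕ → Fin (suc m) → ℕ
  rot s x = (toℕ x + s) % suc m

  -- m * s is an additive inverse of s modulo suc m, since s + m * s = suc m * s.
  unrot : ℕ → ℕ → Fin (suc m)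
  unrot s y = fromℕ< (m%n<n (y + m * s) (suc m))

  toℕ-unrot : ∀ s y → toℕ (unrot s y) ≡ (y + m * s) % suc m
  toℕ-unrot s y = toℕ-fromℕ< (m%n<n (y + m * s) (suc m))

  toℕ-next : ∀ x → toℕ (next x) ≡ suc (toℕ x) % suc m
  toℕ-next x = toℕ-fromℕ< (m%n<n (suc (toℕ x)) (suc m))

  private
    [y+[1+m]*s]%[1+m] : ∀ y s → (y + suc m * s) % suc m ≡ y % suc m
    [y+[1+m]*s]%[1+m] y s =
      trans (cong (λ z → (y + z) % suc m) (*-comm (suc m) s)) ([m+kn]%n≡m%n y s (suc m))

  rot-unrot : ∀ s {y} → y < suc m → rot s (unrot s y) ≡ y
  rot-unrot s {y} y<n = begin
    (toℕ (unrot s y) + s) % suc m       ≡⟨ cong (λ z → (z + s) % suc m) (toℕ-unrot s y) ⟩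
    ((y + m * s) % suc m + s) % suc m   ≡⟨ [m%n+o]%n≡[m+o]%n (y + m * s) s (suc m) ⟩
    (y + m * s + s) % suc m             ≡⟨ cong (_% suc m) (+-assoc y (m * s) s) ⟩
    (y + (m * s + s)) % suc m           ≡⟨ cong (λ z → (y + z) % suc m) (+-comm (m * s) s) ⟩
    (y + suc m * s) % suc m             ≡⟨ [y+[1+m]*s]%[1+m] y s ⟩
    y % suc m                           ≡⟨ m<n⇒m%n≡m y<n ⟩
    y                                   ∎

  unrot-rot : ∀ s x → unrot s (rot s x) ≡ x
  unrot-rot s x = toℕ-injective (begin
    toℕ (unrot s (rot s x))                ≡⟨ toℕ-unrot s (rot s x) ⟩
    ((toℕ x + s) % suc m + m * s) % suc m ≡⟨ [m%n+o]%n≡[m+o]%n (toℕ x + s) (m * s) (suc m) ⟩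
    (toℕ x + s + m * s) % suc m            ≡⟨ cong (_% suc m) (+-assoc (toℕ x) s (m * s)) ⟩
    (toℕ x + suc m * s) % suc m            ≡⟨ [y+[1+m]*s]%[1+m] (toℕ x) s ⟩
    toℕ x % suc m                          ≡⟨ m<n⇒m%n≡m (toℕ<n x) ⟩
    toℕ x                                  ∎)

  rot≡⇒≡unrot : ∀ s {x y} → rot s x ≡ y → x ≡ unrot s y
  rot≡⇒≡unrot s {x} eq = trans (sym (unrot-rot s x)) (cong (unrot s) eq)

  rot-injective : ∀ s {x x′} → rot s x ≡ rot s x′ → x ≡ x′
  rot-injective s {x′ = x′} eq = trans (rot≡⇒≡unrot s eq) (unrot-rot s x′)

  rot-+ : ∀ s t x → rot (s + t) x ≡ (rot s x + t) % suc m
  rot-+ s t x = begin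
    (toℕ x + (s + t)) % suc m        ≡⟨ cong (_% suc m) (+-assoc (toℕ x) s t) ⟨
    (toℕ x + s + t) % suc m          ≡⟨ [m%n+o]%n≡[m+o]%n (toℕ x + s) t (suc m) ⟨
    ((toℕ x + s) % suc m + t) % suc m ∎

  rot-+-multiple : ∀ s q x → rot (s + q * suc m) x ≡ rot s x
  rot-+-multiple s q x = begin
    (toℕ x + (s + q * suc m)) % suc m ≡⟨ cong (_% suc m) (+-assoc (toℕ x) s (q * suc m)) ⟨
    (toℕ x + s + q * suc m) % suc m   ≡⟨ [m+kn]%n≡m%n (toℕ x + s) q (suc m) ⟩
    (toℕ x + s) % suc m               ∎

  rot-next : ∀ s x → rot s (next x) ≡ suc (rot s x) % suc m
  rot-next s x = begin
    (toℕ (next x) + s) % suc m             ≡⟨ cong (λ z → (z + s) % suc m) (toℕ-next x) ⟩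
    (suc (toℕ x) % suc m + s) % suc m      ≡⟨ [m%n+o]%n≡[m+o]%n (suc (toℕ x)) s (suc m) ⟩
    suc (toℕ x + s) % suc m                ≡⟨ cong (_% suc m) (+-comm 1 (toℕ x + s)) ⟩
    (toℕ x + s + 1) % suc m                ≡⟨ [m%n+o]%n≡[m+o]%n (toℕ x + s) 1 (suc m) ⟨
    ((toℕ x + s) % suc m + 1) % suc m      ≡⟨ cong (_% suc m) (+-comm (rot s x) 1) ⟩
    suc (rot s x) % suc m                  ∎

  next-unrot : ∀ s {y} → suc y < suc m → next (unrot s y) ≡ unrot s (suc y)
  next-unrot s {y} y+1<n = rot-injective s (begin
    rot s (next (unrot s y))         ≡⟨ rot-next s (unrot s y) ⟩
    suc (rot s (unrot s y)) % suc m  ≡⟨ cong (λ z → suc z % suc m) (rot-unrot s (<-trans (n<1+n y) y+1<n)) ⟩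
    suc y % suc m                    ≡⟨ m<n⇒m%n≡m y+1<n ⟩
    suc y                            ≡⟨ rot-unrot s y+1<n ⟨
    rot s (unrot s (suc y))          ∎)

  next-≢ : 2 ≤ suc m → (x : Fin (suc m)) → next x ≢ x
  next-≢ 2≤n x eq with m≤n⇒m<n∨m≡n (s≤s⁻¹ (toℕ<n x))
  ... | inj₁ x<m = 1+n≢n (begin
    suc (toℕ x)          ≡⟨ m<n⇒m%n≡m (s≤s x<m) ⟨
    suc (toℕ x) % suc m  ≡⟨ toℕ-next x ⟨
    toℕ (next x)         ≡⟨ cong toℕ eq ⟩
    toℕ x                ∎)
  ... | inj₂ x≡m = <⇒≢ (s≤s⁻¹ 2≤n) (begin
    0                    ≡⟨ n%n≡0 (suc m) ⟨
    suc m % suc m        ≡⟨ cong (λ z → suc z % suc m) x≡m ⟨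
    suc (toℕ x) % suc m  ≡⟨ toℕ-next x ⟨
    toℕ (next x)         ≡⟨ cong toℕ eq ⟩
    toℕ x                ≡⟨ x≡m ⟩
    m                    ∎)

  ∣⁅x⁆∪⁅next-x⁆∣≡2 : 2 ≤ suc m → (x : Fin (suc m)) → ∣ ⁅ x ⁆ ∪ ⁅ next x ⁆ ∣ ≡ 2
  ∣⁅x⁆∪⁅next-x⁆∣≡2 2≤n x = begin
    ∣ ⁅ x ⁆ ∪ ⁅ next x ⁆ ∣ ≡⟨ ∣⁅x⁆∪p∣≡1+∣p∣ x ⁅ next x ⁆ (next-≢ 2≤n x ∘ sym ∘ x∈⁅y⁆⇒x≡y (next x)) ⟩
    suc ∣ ⁅ next x ⁆ ∣     ≡⟨ cong suc (∣⁅x⁆∣≡1 (next x)) ⟩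
    2                      ∎

  lookup-⁅unrot⁆ : ∀ s {y} → y < suc m → ∀ x → lookup ⁅ unrot s y ⁆ x ≡ (rot s x ≡ᵇ y)
  lookup-⁅unrot⁆ s {y} y<n x = ⇔→≡ (mk⇔ to from)
    where
    to : lookup ⁅ unrot s y ⁆ x ≡ true → (rot s x ≡ᵇ y) ≡ true
    to x∈ = Equivalence.from ≡ᵇ≡true⇔≡
      (trans (cong (rot s) (Equivalence.to (lookup⁅⁆≡true⇔≡ (unrot s y) x) x∈)) (rot-unrot s y<n))
    from : (rot s x ≡ᵇ y) ≡ true → lookup ⁅ unrot s y ⁆ x ≡ true
    from eq = Equivalence.from (lookup⁅⁆≡true⇔≡ (unrot s y) x) (rot≡⇒≡unrot s (Equivalence.to ≡ᵇ≡true⇔≡ eq))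

  points : ℕ → List ℕ → Subset (suc m)
  points s []       = ∅
  points s (y ∷ ys) = ⁅ unrot s y ⁆ ∪ points s ys

  lookup-points : ∀ s {ys} → All (_< suc m) ys → ∀ x → lookup (points s ys) x ≡ rot s x ∈ᵇ ys
  lookup-points s []           x = lookup-replicate x false
  lookup-points s {y ∷ ys} (y<n ∷ ys<n) x = trans (lookup-zipWith _∨_ x ⁅ unrot s y ⁆ (points s ys))
    (cong₂ _∨_ (lookup-⁅unrot⁆ s y<n x) (lookup-points s ys<n x))

  ∣points∣ : ∀ s {ys} → All (_< suc m) ys → T (distinctᵇ ys) → ∣ points s ys ∣ ≡ length ys
  ∣points∣ s             []           _        = ∣⊥∣≡0 (suc m)
  ∣points∣ s {y ∷ ys} (y<n ∷ ys<n) distinct =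
    trans (∣⁅x⁆∪p∣≡1+∣p∣ (unrot s y) (points s ys) y∉ys) (cong suc (∣points∣ s ys<n distinct-ys))
    where
    y∉ysᵇ         = proj₁ (Equivalence.to T-∧ distinct)
    distinct-ys   = proj₂ (Equivalence.to T-∧ distinct)
    y∉ys : unrot s y ∉ points s ys
    y∉ys = lookup≡false⇒∉ (begin
      lookup (points s ys) (unrot s y) ≡⟨ lookup-points s ys<n (unrot s y) ⟩
      rot s (unrot s y) ∈ᵇ ys          ≡⟨ cong (_∈ᵇ ys) (rot-unrot s y<n) ⟩
      y ∈ᵇ ys                          ≡⟨ Equivalence.to T-not-≡ y∉ysᵇ ⟩
      false                            ∎)

SmallOrCycleEdge : ∀ {m} → Subset (suc m) → Set
SmallOrCycleEdge S = ∣ S ∣ ≤ 1 ⊎ CycleEdge S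

module _ {m : ℕ} {S : Subset (suc m)} where

  small⇒∣∣≢5 : 2 ≤ suc m → SmallOrCycleEdge S → ∣ S ∣ ≢ 5
  small⇒∣∣≢5 _   (inj₁ ∣S∣≤1)      ∣S∣≡5 with s≤s () ← subst (_≤ 1) ∣S∣≡5 ∣S∣≤1
  small⇒∣∣≢5 2≤n (inj₂ (x , refl)) ∣S∣≡5 with () ← trans (sym (∣⁅x⁆∪⁅next-x⁆∣≡2 2≤n x)) ∣S∣≡5

  small⇒cycleEdge : SmallOrCycleEdge S → 2 ≤ ∣ S ∣ → CycleEdge S
  small⇒cycleEdge (inj₁ ∣S∣≤1) 2≤∣S∣ with s≤s () ← ≤-trans 2≤∣S∣ ∣S∣≤1
  small⇒cycleEdge (inj₂ cycle) _     = cycle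

adjacentAt : ℕ → ℕ → Bool
adjacentAt y₀ y = (y ≡ᵇ y₀) ∨ (y ≡ᵇ suc y₀)

data Overlap (G : ℕ → Bool) : Set where
  adjacent  : ∀ y₀ → y₀ ≤ 11 → (∀ y → G y ≡ adjacentAt y₀ y) → Overlap G
  atMostOne : ∀ y₁ → (∀ y → G y ≡ true → y ≡ y₁) → Overlap G

Overlap-cong : ∀ {G H} → (∀ y → G y ≡ H y) → Overlap H → Overlap G
Overlap-cong G≗H (adjacent y₀ y₀≤11 H≗) = adjacent y₀ y₀≤11 (λ y → trans (G≗H y) (H≗ y))
Overlap-cong G≗H (atMostOne y₁ unique)  = atMostOne y₁ (λ y Gy → unique y (trans (sym (G≗H y)) Gy))

module _ {m : ℕ} where

  lookup-adjacent⇒cycleEdge : ∀ s {y₀} {S : Subset (suc m)} → suc y₀ < suc m →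
    (∀ x → lookup S x ≡ adjacentAt y₀ (rot s x)) → S ≡ ⁅ unrot s y₀ ⁆ ∪ ⁅ next (unrot s y₀) ⁆
  lookup-adjacent⇒cycleEdge s {y₀} {S} y₀+1<n lookup-S = lookup-≗⇒≡ λ x → begin
    lookup S x
      ≡⟨ lookup-S x ⟩
    (rot s x ≡ᵇ y₀) ∨ (rot s x ≡ᵇ suc y₀)
      ≡⟨ cong₂ _∨_ (lookup-⁅unrot⁆ s y₀<n x) (lookup-⁅unrot⁆ s y₀+1<n x) ⟨
    lookup ⁅ u ⁆ x ∨ lookup ⁅ unrot s (suc y₀) ⁆ x
      ≡⟨ cong (λ v → lookup ⁅ u ⁆ x ∨ lookup ⁅ v ⁆ x) (next-unrot s y₀+1<n) ⟨
    lookup ⁅ u ⁆ x ∨ lookup ⁅ next u ⁆ x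
      ≡⟨ lookup-zipWith _∨_ x ⁅ u ⁆ ⁅ next u ⁆ ⟨
    lookup (⁅ u ⁆ ∪ ⁅ next u ⁆) x
      ∎
    where
    u = unrot s y₀
    y₀<n = <-trans (n<1+n y₀) y₀+1<n

  overlap⇒small : ∀ s {G} {S : Subset (suc m)} → 13 ≤ suc m → Overlap G →
    (∀ x → lookup S x ≡ G (rot s x)) → SmallOrCycleEdge S
  overlap⇒small s 13≤n (adjacent y₀ y₀≤11 G≗) lookup-S = inj₂ (unrot s y₀ ,
    lookup-adjacent⇒cycleEdge s (≤-trans (s≤s (s≤s y₀≤11)) 13≤n) (λ x → trans (lookup-S x) (G≗ (rot s x))))
  overlap⇒small s {S = S} _ (atMostOne y₁ unique) lookup-S =
    inj₁ (≤-trans (p⊆q⇒∣p∣≤∣q∣ S⊆⁅u⁆) (≤-reflexive (∣⁅x⁆∣≡1 (unrot s y₁))))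
    where
    S⊆⁅u⁆ : S ⊆ ⁅ unrot s y₁ ⁆
    S⊆⁅u⁆ {x} x∈S = subst (_∈ₛ ⁅ unrot s y₁ ⁆)
      (sym (rot≡⇒≡unrot s (unique (rot s x) (trans (sym (lookup-S x)) ([]=⇒lookup x∈S)))))
      (x∈⁅x⁆ (unrot s y₁))

data Kind : Set where
  P Q R : Kind

positions : Kind → List ℕ
positions P = 0 ∷ 1 ∷ 2 ∷ 3 ∷ 4 ∷ []
positions Q = 2 ∷ 3 ∷ 8 ∷ 9 ∷ 10 ∷ []
positions R = 4 ∷ 5 ∷ 6 ∷ 11 ∷ 12 ∷ []

occupies : Kind → ℕ → Bool
occupies t y = y ∈ᵇ positions t

length-positions : ∀ t → length (positions t) ≡ 5
length-positions P = refl
length-positions Q = refl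
length-positions R = refl

positions-distinct : ∀ t → T (distinctᵇ (positions t))
positions-distinct P = _
positions-distinct Q = _
positions-distinct R = _

positions-<13 : ∀ t → All (_< 13) (positions t)
positions-<13 P = toWitness {a? = All.all? (_<? 13) (positions P)} _
positions-<13 Q = toWitness {a? = All.all? (_<? 13) (positions Q)} _
positions-<13 R = toWitness {a? = All.all? (_<? 13) (positions R)} _

occupies-13+ : ∀ t z → occupies t (13 + z) ≡ false
occupies-13+ P z = refl
occupies-13+ Q z = refl
occupies-13+ R z = refl

occupies-≥13 : ∀ t {y} → 13 ≤ y → occupies t y ≡ false
occupies-≥13 t {y} 13≤y = subst (λ y → occupies t y ≡ false) (m+[n∸m]≡n 13≤y) (occupies-13+ t (y ∸ 13))

meet : (n : ℕ) .{{_ : NonZero n}} → ℕ → Kind → Kind → ℕ → Bool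
meet n c t t′ y = occupies t y ∧ occupies t′ ((y + 5 * c) % n)

meet∞ : ℕ → Kind → Kind → ℕ → Bool
meet∞ c t t′ y = occupies t y ∧ occupies t′ (y + 5 * c)

meet≗meet∞ : ∀ n .{{_ : NonZero n}} c t t′ → 13 + 5 * c ≤ n →
  ∀ y → meet n c t t′ y ≡ meet∞ c t t′ y
meet≗meet∞ n c t t′ 13+5c≤n y with y ≤? 12
... | yes y≤12 = cong (λ z → occupies t y ∧ occupies t′ z)
  (m<n⇒m%n≡m (≤-trans (s≤s (+-monoˡ-≤ (5 * c) y≤12)) 13+5c≤n))
... | no  y≰12 = trans (cong (_∧ occupies t′ ((y + 5 * c) % n)) t∌y)
  (sym (cong (_∧ occupies t′ (y + 5 * c)) t∌y))
  where t∌y = occupies-≥13 t (≰⇒> y≰12)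

adjacentBy : ∀ {G} y₀ → {T (y₀ ≤ᵇ 11)} → applyUpTo G 13 ≡ applyUpTo (adjacentAt y₀) 13 →
  (∀ z → G (13 + z) ≡ adjacentAt y₀ (13 + z)) → Overlap G
adjacentBy y₀ {y₀≤11} prefix tail = adjacent y₀ (≤ᵇ⇒≤ y₀ 11 y₀≤11) (≗-fromPrefix 13 prefix tail)

singleAt : ∀ {G} y₁ → applyUpTo G 13 ≡ applyUpTo (_≡ᵇ y₁) 13 →
  (∀ z → G (13 + z) ≡ (13 + z ≡ᵇ y₁)) → Overlap G
singleAt {G} y₁ prefix tail = atMostOne y₁ λ y Gy →
  Equivalence.to ≡ᵇ≡true⇔≡ (trans (sym (≗-fromPrefix 13 {G} {_≡ᵇ y₁} prefix tail y)) Gy)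

nowhere : ∀ {G} → applyUpTo G 13 ≡ applyUpTo (λ _ → false) 13 →
  (∀ z → G (13 + z) ≡ false) → Overlap G
nowhere {G} prefix tail = atMostOne 0 λ y Gy →
  contradiction (trans (sym (≗-fromPrefix 13 {G} {λ _ → false} prefix tail y)) Gy) λ ()

meet∞-overlap : ∀ c t t′ → (c ≡ 0 → t ≢ t′) → Overlap (meet∞ c t t′)
meet∞-overlap 0 P P P≢P = contradiction refl (P≢P refl)
meet∞-overlap 0 P Q _   = adjacentBy 2 refl (λ _ → refl)
meet∞-overlap 0 P R _   = singleAt 4 refl (λ _ → refl)
meet∞-overlap 0 Q P _   = adjacentBy 2 refl (λ _ → refl)
meet∞-overlap 0 Q Q Q≢Q = contradiction refl (Q≢Q refl)
meet∞-overlap 0 Q R _   = nowhere refl (λ _ → refl)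
meet∞-overlap 0 R P _   = singleAt 4 refl (λ _ → refl)
meet∞-overlap 0 R Q _   = nowhere refl (λ _ → refl)
meet∞-overlap 0 R R R≢R = contradiction refl (R≢R refl)
meet∞-overlap 1 P P _   = nowhere refl (λ _ → refl)
meet∞-overlap 1 P Q _   = adjacentBy 3 refl (λ _ → refl)
meet∞-overlap 1 P R _   = adjacentBy 0 refl (λ _ → refl)
meet∞-overlap 1 Q P _   = nowhere refl (λ _ → refl)
meet∞-overlap 1 Q Q _   = singleAt 3 refl (λ _ → refl)
meet∞-overlap 1 Q R _   = nowhere refl (λ _ → refl)
meet∞-overlap 1 R P _   = nowhere refl (λ _ → refl)
meet∞-overlap 1 R Q _   = adjacentBy 4 refl (λ _ → refl)
meet∞-overlap 1 R R _   = singleAt 6 refl (λ _ → refl)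
meet∞-overlap 2 P P _   = nowhere refl (λ _ → refl)
meet∞-overlap 2 P Q _   = singleAt 0 refl (λ _ → refl)
meet∞-overlap 2 P R _   = adjacentBy 1 refl (λ _ → refl)
meet∞-overlap 2 Q P _   = nowhere refl (λ _ → refl)
meet∞-overlap 2 Q Q _   = nowhere refl (λ _ → refl)
meet∞-overlap 2 Q R _   = singleAt 2 refl (λ _ → refl)
meet∞-overlap 2 R P _   = nowhere refl (λ _ → refl)
meet∞-overlap 2 R Q _   = nowhere refl (λ _ → refl)
meet∞-overlap 2 R R _   = nowhere refl (λ _ → refl)
meet∞-overlap c@(suc (suc (suc _))) t t′ _ = atMostOne 0 λ y overlaps →
  contradiction (trans (sym overlaps) (disjoint y)) λ ()
  where
  disjoint : ∀ y → meet∞ c t t′ y ≡ false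
  disjoint y = trans (cong (occupies t y ∧_) (occupies-≥13 t′ 13≤y+5c)) (∧-zeroʳ (occupies t y))
    where
    13≤y+5c = ≤-trans (m≤m+n 13 2) (≤-trans (*-monoʳ-≤ 5 (m≤m+n 3 _)) (m≤n+m (5 * c) y))

meet-20-overlap : ∀ t t′ → Overlap (meet 20 2 t t′)
meet-20-overlap P P = nowhere refl (λ _ → refl)
meet-20-overlap P Q = singleAt 0 refl (λ _ → refl)
meet-20-overlap P R = adjacentBy 1 refl (λ _ → refl)
meet-20-overlap Q P = singleAt 10 refl (λ _ → refl)
meet-20-overlap Q Q = nowhere refl (λ _ → refl)
meet-20-overlap Q R = singleAt 2 refl (λ _ → refl)
meet-20-overlap R P = adjacentBy 11 refl (λ _ → refl)
meet-20-overlap R Q = singleAt 12 refl (λ _ → refl)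
meet-20-overlap R R = nowhere refl (λ _ → refl)

unwrapped-bound : ∀ {c K} → c + 3 ≤ K → 13 + 5 * c ≤ 5 * K
unwrapped-bound {c} c+3≤K = ≤-trans (+-monoˡ-≤ (5 * c) (m≤m+n 13 2))
  (≤-trans (≤-reflexive (15+5c≡5[c+3] c)) (*-monoʳ-≤ 5 c+3≤K))
  where
  15+5c≡5[c+3] : ∀ c → 15 + 5 * c ≡ 5 * (c + 3)
  15+5c≡5[c+3] = solve-∀

meet-overlap-unwrapped : ∀ k c t t′ → c + 3 ≤ suc k → (c ≡ 0 → t ≢ t′) →
  Overlap (meet (5 * suc k) c t t′)
meet-overlap-unwrapped k c t t′ c+3≤K c≡0⇒t≢t′ = Overlap-cong
  (meet≗meet∞ (5 * suc k) c t t′ (unwrapped-bound c+3≤K)) (meet∞-overlap c t t′ c≡0⇒t≢t′)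

meet-overlap-2 : ∀ k → 3 ≤ k → ∀ t t′ → Overlap (meet (5 * suc k) 2 t t′)
meet-overlap-2 1                        (s≤s ())
meet-overlap-2 2                        (s≤s (s≤s ()))
meet-overlap-2 3                        _ t t′ = meet-20-overlap t t′
meet-overlap-2 (suc (suc (suc (suc k)))) _ t t′ = meet-overlap-unwrapped _ 2 t t′ (m≤m+n 5 k) λ ()

meet-overlap-near : ∀ k → 3 ≤ k → ∀ c t t′ → c ≤ 2 → (c ≡ 0 → t ≢ t′) →
  Overlap (meet (5 * suc k) c t t′)
meet-overlap-near k 3≤k 0 t t′ _ t≢t′ = meet-overlap-unwrapped k 0 t t′ (m≤n⇒m≤1+n 3≤k) t≢t′
meet-overlap-near k 3≤k 1 t t′ _ _    = meet-overlap-unwrapped k 1 t t′ (s≤s 3≤k) λ ()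
meet-overlap-near k 3≤k 2 t t′ _ _    = meet-overlap-2 k 3≤k t t′
meet-overlap-near k _ (suc (suc (suc _))) t t′ (s≤s (s≤s ())) _

meet≗adjacent : ∀ k c t t′ r → c + 3 ≤ suc k →
  applyUpTo (meet∞ c t t′) 13 ≡ applyUpTo (adjacentAt r) 13 →
  (∀ z → meet∞ c t t′ (13 + z) ≡ adjacentAt r (13 + z)) →
  ∀ y → meet (5 * suc k) c t t′ y ≡ adjacentAt r y
meet≗adjacent k c t t′ r c+3≤K prefix tail y =
  trans (meet≗meet∞ (5 * suc k) c t t′ (unwrapped-bound c+3≤K) y)
    (≗-fromPrefix 13 {meet∞ c t t′} {adjacentAt r} prefix tail y)

meet-P-R-2 : ∀ k → 3 ≤ k → ∀ y → meet (5 * suc k) 2 P R y ≡ adjacentAt 1 y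
meet-P-R-2 1                        (s≤s ())
meet-P-R-2 2                        (s≤s (s≤s ()))
meet-P-R-2 3                        _ = ≗-fromPrefix 13 {meet 20 2 P R} {adjacentAt 1} refl (λ _ → refl)
meet-P-R-2 (suc (suc (suc (suc k)))) _ = meet≗adjacent _ 2 P R 1 (m≤m+n 5 k) refl (λ _ → refl)

meet-adjacent : ∀ k → 3 ≤ k → ∀ r → r < 5 →
  ∃[ c ] ∃[ t ] ∃[ t′ ] (∀ y → meet (5 * suc k) c t t′ y ≡ adjacentAt r y)
meet-adjacent k 3≤k 0 _ = 1 , P , R , meet≗adjacent k 1 P R 0 (s≤s 3≤k) refl (λ _ → refl)
meet-adjacent k 3≤k 1 _ = 2 , P , R , meet-P-R-2 k 3≤k
meet-adjacent k 3≤k 2 _ = 0 , P , Q , meet≗adjacent k 0 P Q 2 (m≤n⇒m≤1+n 3≤k) refl (λ _ → refl)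
meet-adjacent k 3≤k 3 _ = 1 , P , Q , meet≗adjacent k 1 P Q 3 (s≤s 3≤k) refl (λ _ → refl)
meet-adjacent k 3≤k 4 _ = 1 , R , Q , meet≗adjacent k 1 R Q 4 (s≤s 3≤k) refl (λ _ → refl)
meet-adjacent k _ (suc (suc (suc (suc (suc _))))) (s≤s (s≤s (s≤s (s≤s (s≤s ())))))

_≟ₖ_ : DecidableEquality Kind
P ≟ₖ P = yes refl
P ≟ₖ Q = no λ ()
P ≟ₖ R = no λ ()
Q ≟ₖ P = no λ ()
Q ≟ₖ Q = yes refl
Q ≟ₖ R = no λ ()
R ≟ₖ P = no λ ()
R ≟ₖ Q = no λ ()
R ≟ₖ R = yes refl

kinds : List Kind
kinds = P ∷ Q ∷ R ∷ []

kinds-unique : Unique kinds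
kinds-unique = ((λ ()) ∷ (λ ()) ∷ []) ∷ ((λ ()) ∷ []) ∷ [] ∷ []

∈-kinds : ∀ t → t ∈ kinds
∈-kinds P = here refl
∈-kinds Q = there (here refl)
∈-kinds R = there (there (here refl))

module Construction (k : ℕ) (3≤k : 3 ≤ k) where

  K n : ℕ
  K = suc k
  n = 5 * K

  13≤n : 13 ≤ n
  13≤n = ≤-trans (m≤m+n 13 7) (*-monoʳ-≤ 5 (s≤s 3≤k))

  2≤n : 2 ≤ n
  2≤n = ≤-trans (m≤m+n 2 11) 13≤n

  -- Edge j of kind t is the pattern of t placed at the start of block -j (indices mod n).
  edge : ℕ → Kind → Subset n
  edge j t = tabulate (λ x → occupies t (rot (5 * j) x))

  ∣edge∣≡5 : ∀ j t → ∣ edge j t ∣ ≡ 5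
  ∣edge∣≡5 j t = begin
    ∣ edge j t ∣                      ≡⟨ cong ∣_∣ edge≡points ⟩
    ∣ points (5 * j) (positions t) ∣  ≡⟨ ∣points∣ (5 * j) positions<n (positions-distinct t) ⟩
    length (positions t)             ≡⟨ length-positions t ⟩
    5                                ∎
    where
    positions<n = All.map (λ y<13 → ≤-trans y<13 13≤n) (positions-<13 t)
    edge≡points : edge j t ≡ points (5 * j) (positions t)
    edge≡points = lookup-≗⇒≡ λ x →
      trans (lookup∘tabulate (λ x → occupies t (rot (5 * j) x)) x)
            (sym (lookup-points (5 * j) positions<n x))

  ∣edge∩edge∣≡5 : ∀ j t {e} → edge j t ≡ e → ∣ edge j t ∩ e ∣ ≡ 5
  ∣edge∩edge∣≡5 j t refl = trans (cong ∣_∣ (∩-idem (edge j t))) (∣edge∣≡5 j t)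

  edge-+-multiple : ∀ j q t → edge (j + q * K) t ≡ edge j t
  edge-+-multiple j q t = tabulate-cong λ x → cong (occupies t) (begin
    rot (5 * (j + q * K)) x  ≡⟨ cong (λ s → rot s x) (distrib j q K) ⟩
    rot (5 * j + q * n) x    ≡⟨ rot-+-multiple (5 * j) q x ⟩
    rot (5 * j) x            ∎)
    where
    distrib : ∀ j q K → 5 * (j + q * K) ≡ 5 * j + q * (5 * K)
    distrib = solve-∀

  edge-% : ∀ j t → edge j t ≡ edge (j % K) t
  edge-% j t = begin
    edge j t                   ≡⟨ cong (λ i → edge i t) (m≡m%n+[m/n]*n j K) ⟩
    edge (j % K + j / K * K) t ≡⟨ edge-+-multiple (j % K) (j / K) t ⟩
    edge (j % K) t             ∎

  lookup-edge∩edge : ∀ j c t t′ x →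
    lookup (edge j t ∩ edge (j + c) t′) x ≡ meet n c t t′ (rot (5 * j) x)
  lookup-edge∩edge j c t t′ x = begin
    lookup (edge j t ∩ edge (j + c) t′) x
      ≡⟨ lookup-zipWith _∧_ x (edge j t) (edge (j + c) t′) ⟩
    lookup (edge j t) x ∧ lookup (edge (j + c) t′) x
      ≡⟨ cong₂ _∧_ (lookup∘tabulate (λ x → occupies t (rot (5 * j) x)) x)
                  (lookup∘tabulate (λ x → occupies t′ (rot (5 * (j + c)) x)) x) ⟩
    occupies t (rot (5 * j) x) ∧ occupies t′ (rot (5 * (j + c)) x)
      ≡⟨ cong (λ s → occupies t (rot (5 * j) x) ∧ occupies t′ (rot s x)) (*-distribˡ-+ 5 j c) ⟩
    occupies t (rot (5 * j) x) ∧ occupies t′ (rot (5 * j + 5 * c) x)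
      ≡⟨ cong (λ y → occupies t (rot (5 * j) x) ∧ occupies t′ y) (rot-+ (5 * j) (5 * c) x) ⟩
    meet n c t t′ (rot (5 * j) x)
      ∎

  edge∩edge+-small : ∀ j c t t′ → Overlap (meet n c t t′) →
    SmallOrCycleEdge (edge j t ∩ edge (j + c) t′)
  edge∩edge+-small j c t t′ shape = overlap⇒small (5 * j) 13≤n shape (lookup-edge∩edge j c t t′)

  -- Blocks at distance c ≥ 3 are compared the other way round, at distance K - c across the wrap.
  ordered-edge∩edge-small : ∀ {a b} t t′ → a ≤ b → b < K → (a ≡ b → t ≢ t′) →
    SmallOrCycleEdge (edge a t ∩ edge b t′)
  ordered-edge∩edge-small {a} {b} t t′ a≤b b<K a≡b⇒t≢t′ with b ∸ a ≤? 2
  ... | yes c≤2 = subst (λ i → SmallOrCycleEdge (edge a t ∩ edge i t′)) a+c≡b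
    (edge∩edge+-small a c t t′ (meet-overlap-near k 3≤k c t t′ c≤2 (a≡b⇒t≢t′ ∘ c≡0⇒a≡b)))
    where
    c = b ∸ a
    a+c≡b = m+[n∸m]≡n a≤b
    c≡0⇒a≡b : c ≡ 0 → a ≡ b
    c≡0⇒a≡b c≡0 = trans (sym (+-identityʳ a)) (trans (cong (a +_) (sym c≡0)) a+c≡b)
  ... | no c≰2 = subst SmallOrCycleEdge (trans (cong (edge b t′ ∩_) wrap) (∩-comm (edge b t′) (edge a t)))
    (edge∩edge+-small b c′ t′ t (meet-overlap-unwrapped k c′ t′ t c′+3≤K
      λ c′≡0 → contradiction (m∸n≡0⇒m≤n c′≡0) (<⇒≱ c<K)))
    where
    c = b ∸ a
    c′ = K ∸ c
    c<K = ≤-<-trans (m∸n≤m b a) b<K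
    3≤c = ≰⇒> c≰2
    c′+3≤K : c′ + 3 ≤ K
    c′+3≤K = ≤-trans (+-monoˡ-≤ 3 (∸-monoʳ-≤ K 3≤c)) (≤-reflexive (m∸n+n≡m (≤-trans 3≤c (<⇒≤ c<K))))
    wrap : edge (b + c′) t ≡ edge a t
    wrap = begin
      edge (b + c′) t      ≡⟨ cong (λ i → edge (i + c′) t) (m+[n∸m]≡n a≤b) ⟨
      edge (a + c + c′) t  ≡⟨ cong (λ i → edge i t) (+-assoc a c c′) ⟩
      edge (a + (c + c′)) t ≡⟨ cong (λ i → edge (a + i) t) (m+[n∸m]≡n (<⇒≤ c<K)) ⟩
      edge (a + K) t       ≡⟨ cong (λ i → edge (a + i) t) (*-identityˡ K) ⟨
      edge (a + 1 * K) t   ≡⟨ edge-+-multiple a 1 t ⟩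
      edge a t             ∎

  edge∩edge-small : ∀ (a b : Fin K) t t′ → ¬ (a ≡ b × t ≡ t′) →
    SmallOrCycleEdge (edge (toℕ a) t ∩ edge (toℕ b) t′)
  edge∩edge-small a b t t′ ≢ with ≤-total (toℕ a) (toℕ b)
  ... | inj₁ a≤b = ordered-edge∩edge-small t t′ a≤b (toℕ<n b)
    λ a≡b t≡t′ → ≢ (toℕ-injective a≡b , t≡t′)
  ... | inj₂ b≤a = subst SmallOrCycleEdge (∩-comm (edge (toℕ b) t′) (edge (toℕ a) t))
    (ordered-edge∩edge-small t′ t b≤a (toℕ<n a) λ b≡a t′≡t → ≢ (toℕ-injective (sym b≡a) , sym t′≡t))

  edge-injective : ∀ {a b : Fin K} {t t′} → edge (toℕ a) t ≡ edge (toℕ b) t′ → a ≡ b × t ≡ t′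
  edge-injective {a} {b} {t} {t′} eq = decidable-stable (a Fin.≟ b ×-dec t ≟ₖ t′) λ ≢ →
    small⇒∣∣≢5 2≤n (edge∩edge-small a b t t′ ≢) (∣edge∩edge∣≡5 (toℕ a) t eq)

  ℋ : Hypergraph n
  ℋ = record
    { edges  = cartesianProductWith (λ a t → edge (toℕ a) t) (allFin K) kinds
    ; unique = cartesianProductWith⁺ _ edge-injective (allFin⁺ K) kinds-unique
    }

  ∈-edges⁻ : ∀ {e} → e ∈ edges ℋ → ∃[ a ] ∃[ t ] e ≡ edge (toℕ a) t
  ∈-edges⁻ e∈ with a , t , _ , _ , e≡ ← ∈-cartesianProductWith⁻ _ (allFin K) kinds e∈ = a , t , e≡

  edge∈edges : ∀ j t → edge j t ∈ edges ℋ
  edge∈edges j t =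
    subst (_∈ edges ℋ) (sym (trans (edge-% j t) (cong (λ i → edge i t) (sym (toℕ-fromℕ< j%K<K)))))
      (∈-cartesianProductWith⁺ _ (∈-allFin (fromℕ< j%K<K)) (∈-kinds t))
    where j%K<K = m%n<n j K

  ℋ-uniform : Uniform 5 ℋ
  ℋ-uniform = All.tabulate λ e∈ → let a , t , e≡ = ∈-edges⁻ e∈ in
    trans (cong ∣_∣ e≡) (∣edge∣≡5 (toℕ a) t)

  ℋ-size : length (edges ℋ) ≡ 3 * K
  ℋ-size = begin
    length (edges ℋ)                 ≡⟨ length-cartesianProductWith _ (allFin K) kinds ⟩
    length (allFin K) * 3            ≡⟨ cong (_* 3) (length-tabulate {n = K} (λ a → a)) ⟩
    K * 3                            ≡⟨ *-comm K 3 ⟩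
    3 * K                            ∎

  EIEdge⇒CycleEdge : ∀ S → EIEdge ℋ S → CycleEdge S
  EIEdge⇒CycleEdge S (e₁ , e₂ , e₁∈ , e₂∈ , e₁≢e₂ , S≡e₁∩e₂ , 2≤∣S∣)
    with a , t , refl ← ∈-edges⁻ e₁∈ | b , t′ , refl ← ∈-edges⁻ e₂∈
    = small⇒cycleEdge (subst SmallOrCycleEdge (sym S≡e₁∩e₂) (edge∩edge-small a b t t′ ≢)) 2≤∣S∣
    where
    ≢ : ¬ (a ≡ b × t ≡ t′)
    ≢ (refl , refl) = e₁≢e₂ refl

  rot-block : ∀ (x : Fin n) → rot (5 * (K ∸ toℕ x / 5)) x ≡ toℕ x % 5
  rot-block x = begin
    (toℕ x + 5 * (K ∸ q)) % n        ≡⟨ cong (λ z → (z + 5 * (K ∸ q)) % n) (m≡m%n+[m/n]*n (toℕ x) 5) ⟩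
    (r + q * 5 + 5 * (K ∸ q)) % n    ≡⟨ cong (_% n) (+-assoc r (q * 5) (5 * (K ∸ q))) ⟩
    (r + (q * 5 + 5 * (K ∸ q))) % n  ≡⟨ cong (λ z → (r + (z + 5 * (K ∸ q))) % n) (*-comm q 5) ⟩
    (r + (5 * q + 5 * (K ∸ q))) % n  ≡⟨ cong (λ z → (r + z) % n) (*-distribˡ-+ 5 q (K ∸ q)) ⟨
    (r + 5 * (q + (K ∸ q))) % n      ≡⟨ cong (λ z → (r + 5 * z) % n) (m+[n∸m]≡n (<⇒≤ q<K)) ⟩
    (r + n) % n                      ≡⟨ [m+n]%n≡m%n r n ⟩
    r % n                            ≡⟨ m<n⇒m%n≡m (≤-trans (m%n<n (toℕ x) 5) (≤-trans (m≤m+n 5 8) 13≤n)) ⟩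
    r                                ∎
    where
    q = toℕ x / 5
    r = toℕ x % 5
    q<K : q < K
    q<K = m<n*o⇒m/o<n (subst (toℕ x <_) (*-comm 5 K) (toℕ<n x))

  CycleEdge⇒EIEdge : ∀ S → CycleEdge S → EIEdge ℋ S
  CycleEdge⇒EIEdge S (x , refl)
    with c , t , t′ , meet≗ ← meet-adjacent k 3≤k (toℕ x % 5) (m%n<n (toℕ x) 5) =
    edge j t , edge (j + c) t′ , edge∈edges j t , edge∈edges (j + c) t′ , distinct , sym ∩≡cycle ,
    ≤-reflexive (sym (∣⁅x⁆∪⁅next-x⁆∣≡2 2≤n x))
    where
    j = K ∸ toℕ x / 5
    ∩≡cycle : edge j t ∩ edge (j + c) t′ ≡ ⁅ x ⁆ ∪ ⁅ next x ⁆
    ∩≡cycle = subst (λ u → edge j t ∩ edge (j + c) t′ ≡ ⁅ u ⁆ ∪ ⁅ next u ⁆)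
      (sym (rot≡⇒≡unrot (5 * j) (rot-block x)))
      (lookup-adjacent⇒cycleEdge (5 * j) (≤-trans (s≤s (m%n<n (toℕ x) 5)) (≤-trans (m≤m+n 6 7) 13≤n))
        λ y → trans (lookup-edge∩edge j c t t′ y) (meet≗ (rot (5 * j) y)))
    distinct : edge j t ≢ edge (j + c) t′
    distinct eq = small⇒∣∣≢5 2≤n (inj₂ (x , ∩≡cycle)) (∣edge∩edge∣≡5 j t eq)

theorem9 : (k m : ℕ) → suc m ≡ 5 * k → suc m ≥ 20 →
    Σ (Hypergraph (suc m)) λ H →
      Uniform 5 H × EIisCycle H × length (edges H) ≡ 3 * k
theorem9 zero    _ ()   _
theorem9 (suc k) _ refl 20≤n =
  ℋ , ℋ-uniform , (λ S → EIEdge⇒CycleEdge S , CycleEdge⇒EIEdge S) , ℋ-size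
  where open Construction k (s≤s⁻¹ (*-cancelˡ-≤ 5 20≤n))
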